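{- (Correctness of types.) Let $g:\mathbb N\to\mathbb N$ satisfy $h<g(h)$ for all $h$. For every environment $C$ and terms $T_1,T_2$: if $C\vdash_g T_1:T_2$, then there exists a term $T_3$ such that $C\vdash_g T_2:T_3$.
   Context: Terms of $\lambda\delta$: $T ::= \ast h \mid x \mid \lambda x{:}W.\,T \mid \delta x{=}V.\,T \mid \mathrm{appl}(V,T) \mid \mathrm{cast}(W,T)$ ($h\in\mathbb N$, $x$ a variable); $\ast h$ is a sort, $\lambda x{:}W.T$ abstraction over type $W$, $\delta x{=}V.T$ the abbreviation "let $x=V$ in $T$", $\mathrm{appl}(V,T)$ application of $T$ to argument $V$, $\mathrm{cast}(W,T)$ $T$ annotated with type $W$. In $\lambda x{:}W.T$, $\delta x{=}V.T$, $x$ is bound in $T$ only; $\mathrm{FV}(T)$ free variables; terms up to renaming of bound variables with bound and free names disjoint. Environments: $E ::= \ast h \mid \lambda x{:}W.E \mid \delta x{=}V.E \mid \mathrm{appl}(V,E)\mid\mathrm{cast}(W,E)$. $E.\lambda x{:}W$ (resp. $E.\delta x{=}V$) is $E$ with its terminal sort $\ast h$ replaced by $\lambda x{:}W.\ast h$ (resp. $\delta x{=}V.\ast h$). $E=C_1\cdot\beta\cdot C_2$, for an item $\beta$ of the form $\lambda x{:}W$ or $\delta x{=}V$, means $E$ is obtained from the environment $C_1$ by replacing its terminal sort with $\beta.C_2$ for some environment $C_2$. Strict substitution: $T[x:=^+W]\,T'$ iff $x\notin\mathrm{FV}(W)$, $x\in\mathrm{FV}(T)$ and $T'$ arises from $T$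 by replacing a nonempty set of free occurrences of $x$ by $W$. Environment-free parallel reduction $\to_0$: least relation closed under (refl) $T\to_0T$; (compatibility) if $A_1\to_0A_2$, $T_1\to_0T_2$ then $\lambda x{:}A_1.T_1\to_0\lambda x{:}A_2.T_2$, $\delta x{=}A_1.T_1\to_0\delta x{=}A_2.T_2$, $\mathrm{appl}(A_1,T_1)\to_0\mathrm{appl}(A_2,T_2)$, $\mathrm{cast}(A_1,T_1)\to_0\mathrm{cast}(A_2,T_2)$; ($\beta$) if $V_1\to_0V_2$, $T_1\to_0T_2$ then $\mathrm{appl}(V_1,\lambda x{:}W.T_1)\to_0\delta x{=}V_2.T_2$; ($\delta$) if $V_1\to_0V_2$, $T_1\to_0T_2$, $T_2[x:=^+V_2]T$ then $\delta x{=}V_1.T_1\to_0\delta x{=}V_2.T$; ($\zeta$) if $T_1\to_0T_2$, $x\notin\mathrm{FV}(T_1)$ then $\delta x{=}V.T_1\to_0T_2$; ($\tau$) if $T_1\to_0T_2$ then $\mathrm{cast}(W,T_1)\to_0T_2$; ($\upsilon$) if $V_1\to_0V_3$, $V_2\to_0V_4$, $T_1\to_0T_2$ then $\mathrm{appl}(V_1,\delta x{=}V_2.T_1)\to_0\delta x{=}V_4.\mathrm{appl}(V_3,T_2)$. $E\vdash T_1\to T_2$ iff $T_1\to_0T_2$, or $E=C_1\cdot\delta x{=}V\cdot C_2$, $T_1\to_0T'$, $T'[x:=^+V]T_2$. Conversion $E\vdash T_1\Leftrightarrow T_2$ is its symmetric and transitive closure. Native type assignment $E\vdash_g T:U$ is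 the least relation closed under: (sort) $E\vdash_g\ast h:\ast g(h)$; (def) if $E=C_1\cdot\delta x{=}V\cdot C_2$ and $C_1\vdash_g V:W$ then $E\vdash_g x:W$; (decl) if $E=C_1\cdot\lambda x{:}W\cdot C_2$ and $C_1\vdash_g W:V$ then $E\vdash_g x:W$; (abbr) if $E\vdash_g V:W$ and $E.\delta x{=}V\vdash_g T:U$ then $E\vdash_g\delta x{=}V.T:\delta x{=}V.U$; (abst) if $E\vdash_g W:V$ and $E.\lambda x{:}W\vdash_g T:U$ then $E\vdash_g\lambda x{:}W.T:\lambda x{:}W.U$; (appl) if $E\vdash_g V:W$ and $E\vdash_g T:\lambda x{:}W.U$ then $E\vdash_g\mathrm{appl}(V,T):\mathrm{appl}(V,\lambda x{:}W.U)$; (cast) if $E\vdash_g T:W$ and $E\vdash_g W:V$ then $E\vdash_g\mathrm{cast}(W,T):\mathrm{cast}(V,W)$; (conv) if $E\vdash_g U_2:W$, $E\vdash_g T:U_1$ and $E\vdash U_1\Leftrightarrow U_2$ then $E\vdash_g T:U_2$. -}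

module Defs where

-- The λδ calculus (terms up to renaming of bound variables) rendered with
-- de Bruijn indices: var n refers to the n-th enclosing binder (λ or δ),
-- counting from the innermost one, starting at 0.

open import Data.Nat using (ℕ; zero; suc; _+_; _<_; _≤?_)
open import Data.Product using (Σ; ∃; _×_; _,_)
open import Data.Empty using (⊥)
open import Relation.Nullary using (¬_; yes; no)
open import Relation.Binary.PropositionalEquality using (_≡_)

data Term : Set where
  sort : ℕ → Term
  var  : ℕ → Term
  abst : Term → Term → Term       -- λx:W.T   (binds in T only)
  abbr : Term → Term → Term       -- δx=V.T   (binds in T only)
  appl : Term → Term → Term
  cast : Term → Term → Term

lift : ℕ → ℕ → Term → Term
lift d k (sort h) = sort h
lift d k (var n) with k ≤? n
... | yes _ = var (d + n)
... | no  _ = var n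
lift d k (abst W T) = abst (lift d k W) (lift d (suc k) T)
lift d k (abbr V T) = abbr (lift d k V) (lift d (suc k) T)
lift d k (appl V T) = appl (lift d k V) (lift d k T)
lift d k (cast W T) = cast (lift d k W) (lift d k T)

data Free : ℕ → Term → Set where
  fvar   : ∀ {i} → Free i (var i)
  fabstW : ∀ {i W T} → Free i W → Free i (abst W T)
  fabstT : ∀ {i W T} → Free (suc i) T → Free i (abst W T)
  fabbrV : ∀ {i V T} → Free i V → Free i (abbr V T)
  fabbrT : ∀ {i V T} → Free (suc i) T → Free i (abbr V T)
  fapplV : ∀ {i V T} → Free i V → Free i (appl V T)
  fapplT : ∀ {i V T} → Free i T → Free i (appl V T)
  fcastW : ∀ {i W T} → Free i W → Free i (cast W T)
  fcastT : ∀ {i W T} → Free i T → Free i (cast W T)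

-- SubAny i V T T' : T' arises from T by replacing an arbitrary (possibly
-- empty) set of free occurrences of index i by V (V lives in T's scope;
-- it is lifted when going under binders).
data SubAny : ℕ → Term → Term → Term → Set where
  sa-sort : ∀ {i V h} → SubAny i V (sort h) (sort h)
  sa-keep : ∀ {i V n} → SubAny i V (var n) (var n)
  sa-repl : ∀ {i V} → SubAny i V (var i) V
  sa-abst : ∀ {i V A A' T T'} → SubAny i V A A' → SubAny (suc i) (lift 1 0 V) T T' →
            SubAny i V (abst A T) (abst A' T')
  sa-abbr : ∀ {i V A A' T T'} → SubAny i V A A' → SubAny (suc i) (lift 1 0 V) T T' →
            SubAny i V (abbr A T) (abbr A' T')
  sa-appl : ∀ {i V A A' T T'} → SubAny i V A A' → SubAny i V T T' →
            SubAny i V (appl A T) (appl A' T')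
  sa-cast : ∀ {i V A A' T T'} → SubAny i V A A' → SubAny i V T T' →
            SubAny i V (cast A T) (cast A' T')

-- Strict substitution T[x:=⁺V]T' : as SubAny but with a NONEMPTY set of
-- replaced occurrences (this also forces x ∈ FV(T)).  The side condition
-- x ∉ FV(V) is automatic with de Bruijn indices since V lives outside
-- the scope of the binder of x.
data SubStrict : ℕ → Term → Term → Term → Set where
  ss-repl  : ∀ {i V} → SubStrict i V (var i) V
  ss-abstA : ∀ {i V A A' T T'} → SubStrict i V A A' → SubAny (suc i) (lift 1 0 V) T T' →
             SubStrict i V (abst A T) (abst A' T')
  ss-abstT : ∀ {i V A A' T T'} → SubAny i V A A' → SubStrict (suc i) (lift 1 0 V) T T' →
             SubStrict i V (abst A T) (abst A' T')
  ss-abbrA : ∀ {i V A A' T T'} → SubStrict i V A A' → SubAny (suc i) (lift 1 0 V) T T' →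
             SubStrict i V (abbr A T) (abbr A' T')
  ss-abbrT : ∀ {i V A A' T T'} → SubAny i V A A' → SubStrict (suc i) (lift 1 0 V) T T' →
             SubStrict i V (abbr A T) (abbr A' T')
  ss-applA : ∀ {i V A A' T T'} → SubStrict i V A A' → SubAny i V T T' →
             SubStrict i V (appl A T) (appl A' T')
  ss-applT : ∀ {i V A A' T T'} → SubAny i V A A' → SubStrict i V T T' →
             SubStrict i V (appl A T) (appl A' T')
  ss-castA : ∀ {i V A A' T T'} → SubStrict i V A A' → SubAny i V T T' →
             SubStrict i V (cast A T) (cast A' T')
  ss-castT : ∀ {i V A A' T T'} → SubAny i V A A' → SubStrict i V T T' →
             SubStrict i V (cast A T) (cast A' T')

infix 4 _⇒₀_
data _⇒₀_ : Term → Term → Set where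
  r-refl : ∀ {T} → T ⇒₀ T
  r-abst : ∀ {A₁ A₂ T₁ T₂} → A₁ ⇒₀ A₂ → T₁ ⇒₀ T₂ → abst A₁ T₁ ⇒₀ abst A₂ T₂
  r-abbr : ∀ {A₁ A₂ T₁ T₂} → A₁ ⇒₀ A₂ → T₁ ⇒₀ T₂ → abbr A₁ T₁ ⇒₀ abbr A₂ T₂
  r-appl : ∀ {A₁ A₂ T₁ T₂} → A₁ ⇒₀ A₂ → T₁ ⇒₀ T₂ → appl A₁ T₁ ⇒₀ appl A₂ T₂
  r-cast : ∀ {A₁ A₂ T₁ T₂} → A₁ ⇒₀ A₂ → T₁ ⇒₀ T₂ → cast A₁ T₁ ⇒₀ cast A₂ T₂
  r-beta : ∀ {V₁ V₂ W T₁ T₂} → V₁ ⇒₀ V₂ → T₁ ⇒₀ T₂ → appl V₁ (abst W T₁) ⇒₀ abbr V₂ T₂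
  -- (δ) δx=V₁.T₁ →0 δx=V₂.T  with T₂[x:=⁺V₂]T  (x is index 0 in T₂)
  r-delta : ∀ {V₁ V₂ T₁ T₂ T} → V₁ ⇒₀ V₂ → T₁ ⇒₀ T₂ → SubStrict 0 (lift 1 0 V₂) T₂ T →
            abbr V₁ T₁ ⇒₀ abbr V₂ T
  -- (ζ) δx=V.T₁ →0 T₂  if x ∉ FV(T₁) and T₁ →0 T₂ (T₂ read in the scope of x)
  r-zeta : ∀ {V T₁ T₂} → T₁ ⇒₀ lift 1 0 T₂ → ¬ Free 0 T₁ → abbr V T₁ ⇒₀ T₂
  r-tau : ∀ {W T₁ T₂} → T₁ ⇒₀ T₂ → cast W T₁ ⇒₀ T₂
  -- (υ) appl(V₁, δx=V₂.T₁) →0 δx=V₄.appl(V₃,T₂)  (V₃ moved under the binder)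
  r-upsilon : ∀ {V₁ V₂ V₃ V₄ T₁ T₂} → V₁ ⇒₀ V₃ → V₂ ⇒₀ V₄ → T₁ ⇒₀ T₂ →
              appl V₁ (abbr V₂ T₁) ⇒₀ abbr V₄ (appl (lift 1 0 V₃) T₂)

-- Environments E ::= ∗h | λx:W.E | δx=V.E | appl(V,E) | cast(W,E)
-- (items listed outermost first; the binders λ, δ bind in the rest of E)
data Env : Set where
  esort : ℕ → Env
  eabst : Term → Env → Env
  eabbr : Term → Env → Env
  eappl : Term → Env → Env
  ecast : Term → Env → Env

plug : Env → Env → Env
plug (esort h)   D = D
plug (eabst W E) D = eabst W (plug E D)
plug (eabbr V E) D = eabbr V (plug E D)
plug (eappl V E) D = eappl V (plug E D)
plug (ecast W E) D = ecast W (plug E D)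

tsort : Env → ℕ
tsort (esort h)   = h
tsort (eabst _ E) = tsort E
tsort (eabbr _ E) = tsort E
tsort (eappl _ E) = tsort E
tsort (ecast _ E) = tsort E

_∙λ_ : Env → Term → Env
E ∙λ W = plug E (eabst W (esort (tsort E)))

_∙δ_ : Env → Term → Env
E ∙δ V = plug E (eabbr V (esort (tsort E)))

nb : Env → ℕ
nb (esort _)   = 0
nb (eabst _ E) = suc (nb E)
nb (eabbr _ E) = suc (nb E)
nb (eappl _ E) = nb E
nb (ecast _ E) = nb E

-- E = C₁·β·C₂ is  E ≡ plug C₁ (β C₂); the variable bound by β is then
-- var (nb C₂) in E, and a term X in the scope of C₁ reads as
-- lift (suc (nb C₂)) 0 X in the scope of E.

data Red (E : Env) (T₁ T₂ : Term) : Set where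
  red0 : T₁ ⇒₀ T₂ → Red E T₁ T₂
  redδ : ∀ C₁ V C₂ T' → E ≡ plug C₁ (eabbr V C₂) → T₁ ⇒₀ T' →
         SubStrict (nb C₂) (lift (suc (nb C₂)) 0 V) T' T₂ → Red E T₁ T₂

data Conv (E : Env) : Term → Term → Set where
  c-step  : ∀ {T₁ T₂} → Red E T₁ T₂ → Conv E T₁ T₂
  c-sym   : ∀ {T₁ T₂} → Conv E T₁ T₂ → Conv E T₂ T₁
  c-trans : ∀ {T₁ T₂ T₃} → Conv E T₁ T₂ → Conv E T₂ T₃ → Conv E T₁ T₃

data Typed (g : ℕ → ℕ) : Env → Term → Term → Set where
  t-sort : ∀ {E h} → Typed g E (sort h) (sort (g h))
  t-def  : ∀ {E C₁ V C₂ W} → E ≡ plug C₁ (eabbr V C₂) → Typed g C₁ V W →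
           Typed g E (var (nb C₂)) (lift (suc (nb C₂)) 0 W)
  t-decl : ∀ {E C₁ W C₂ V} → E ≡ plug C₁ (eabst W C₂) → Typed g C₁ W V →
           Typed g E (var (nb C₂)) (lift (suc (nb C₂)) 0 W)
  t-abbr : ∀ {E V W T U} → Typed g E V W → Typed g (E ∙δ V) T U →
           Typed g E (abbr V T) (abbr V U)
  t-abst : ∀ {E W V T U} → Typed g E W V → Typed g (E ∙λ W) T U →
           Typed g E (abst W T) (abst W U)
  t-appl : ∀ {E V W T U} → Typed g E V W → Typed g E T (abst W U) →
           Typed g E (appl V T) (appl V (abst W U))
  t-cast : ∀ {E T W V} → Typed g E T W → Typed g E W V →
           Typed g E (cast W T) (cast V W)
  t-conv : ∀ {E T U₁ U₂ W} → Typed g E U₂ W → Typed g E T U₁ → Conv E U₁ U₂ →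
           Typed g E T U₂

{-# OPTIONS --safe #-}
-- The type W of a variable bound in C = C₁·β·C₂ is typable in C₁ (for λ by the premise,
-- for δ by the induction hypothesis) and has to be carried over to C by weakening. As the
-- rules for δ and λ extend the environment at its innermost end, weakening is proved for a
-- segment inserted at any depth b of an environment, everything below the insertion point
-- being lifted past the new binders; to reason about such splittings, an environment is
-- read as a list of items followed by a terminal sort.
-- For appl(V,T) with T : λx:W.U, the induction hypothesis types λx:W.U, and inverting
-- that typing (through conversions) gives the premises that type appl(V, λx:W.U).

module Submission where

open import Defs
open import Data.Nat using (ℕ; suc; _+_; _<_; _≤_; _≤?_; z≤n; s≤s)
open import Data.Nat.Properties
open import Algebra.Properties.CommutativeSemigroup +-commutativeSemigroup using (x∙yz≈y∙xz)
open import Data.Product using (∃; ∃-syntax; _×_; _,_)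
open import Data.Sum using (_⊎_; inj₁; inj₂)
open import Data.List using (List; []; _∷_; _++_; [_])
open import Data.List.Properties using (++-assoc; ++-identityʳ; ∷-injective)
open import Data.Empty using (⊥-elim)
open import Relation.Nullary using (yes; no)
open import Relation.Binary.PropositionalEquality hiding ([_])
open ≡-Reasoning

liftIdx : ℕ → ℕ → ℕ → ℕ
liftIdx d k n with k ≤? n
... | yes _ = d + n
... | no  _ = n

lift-var : ∀ d k n → lift d k (var n) ≡ var (liftIdx d k n)
lift-var d k n with k ≤? n
... | yes _ = refl
... | no  _ = refl

liftIdx-≥ : ∀ d {k n} → k ≤ n → liftIdx d k n ≡ d + n
liftIdx-≥ d {k} {n} k≤n with k ≤? n
... | yes _   = refl
... | no  k≰n = ⊥-elim (k≰n k≤n)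

liftIdx-< : ∀ d {k n} → n < k → liftIdx d k n ≡ n
liftIdx-< d {k} {n} n<k with k ≤? n
... | yes k≤n = ⊥-elim (<⇒≱ n<k k≤n)
... | no  _   = refl

liftIdx-suc : ∀ d k n → liftIdx d (suc k) (suc n) ≡ suc (liftIdx d k n)
liftIdx-suc d k n with ≤-<-connex k n
... | inj₁ k≤n = begin
  liftIdx d (suc k) (suc n) ≡⟨ liftIdx-≥ d (s≤s k≤n) ⟩
  d + suc n                 ≡⟨ +-suc d n ⟩
  suc (d + n)               ≡⟨ cong suc (liftIdx-≥ d k≤n) ⟨
  suc (liftIdx d k n)       ∎
... | inj₂ n<k = trans (liftIdx-< d (s≤s n<k)) (cong suc (sym (liftIdx-< d n<k)))

liftIdx-comm : ∀ d m {k k'} n → k' ≤ k →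
               liftIdx d (k + m) (liftIdx m k' n) ≡ liftIdx m k' (liftIdx d k n)
liftIdx-comm d m {k} {k'} n k'≤k with ≤-<-connex k' n | ≤-<-connex k n
... | inj₁ k'≤n | inj₁ k≤n = begin
  liftIdx d (k + m) (liftIdx m k' n) ≡⟨ cong (liftIdx d (k + m)) (liftIdx-≥ m k'≤n) ⟩
  liftIdx d (k + m) (m + n)          ≡⟨ liftIdx-≥ d (subst (k + m ≤_) (+-comm n m) (+-monoˡ-≤ m k≤n)) ⟩
  d + (m + n)                        ≡⟨ x∙yz≈y∙xz d m n ⟩
  m + (d + n)                        ≡⟨ liftIdx-≥ m (≤-trans k'≤n (m≤n+m n d)) ⟨
  liftIdx m k' (d + n)               ≡⟨ cong (liftIdx m k') (liftIdx-≥ d k≤n) ⟨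
  liftIdx m k' (liftIdx d k n)       ∎
... | inj₁ k'≤n | inj₂ n<k = begin
  liftIdx d (k + m) (liftIdx m k' n) ≡⟨ cong (liftIdx d (k + m)) (liftIdx-≥ m k'≤n) ⟩
  liftIdx d (k + m) (m + n)          ≡⟨ liftIdx-< d (subst (m + n <_) (+-comm m k) (+-monoʳ-< m n<k)) ⟩
  m + n                              ≡⟨ liftIdx-≥ m k'≤n ⟨
  liftIdx m k' n                     ≡⟨ cong (liftIdx m k') (liftIdx-< d n<k) ⟨
  liftIdx m k' (liftIdx d k n)       ∎
... | inj₂ n<k' | _ = begin
  liftIdx d (k + m) (liftIdx m k' n) ≡⟨ cong (liftIdx d (k + m)) (liftIdx-< m n<k') ⟩
  liftIdx d (k + m) n                ≡⟨ liftIdx-< d (<-≤-trans n<k' (≤-trans k'≤k (m≤m+n k m))) ⟩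
  n                                  ≡⟨ liftIdx-< m n<k' ⟨
  liftIdx m k' n                     ≡⟨ cong (liftIdx m k') (liftIdx-< d (<-≤-trans n<k' k'≤k)) ⟨
  liftIdx m k' (liftIdx d k n)       ∎

liftIdx-comp : ∀ d m {k k'} n → k' ≤ k → k ≤ k' + m →
               liftIdx d k (liftIdx m k' n) ≡ liftIdx (d + m) k' n
liftIdx-comp d m {k} {k'} n k'≤k k≤k'+m with ≤-<-connex k' n
... | inj₁ k'≤n = begin
  liftIdx d k (liftIdx m k' n) ≡⟨ cong (liftIdx d k) (liftIdx-≥ m k'≤n) ⟩
  liftIdx d k (m + n)          ≡⟨ liftIdx-≥ d (≤-trans k≤k'+m (subst (k' + m ≤_) (+-comm n m) (+-monoˡ-≤ m k'≤n))) ⟩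
  d + (m + n)                  ≡⟨ +-assoc d m n ⟨
  d + m + n                    ≡⟨ liftIdx-≥ (d + m) k'≤n ⟨
  liftIdx (d + m) k' n         ∎
... | inj₂ n<k' = begin
  liftIdx d k (liftIdx m k' n) ≡⟨ cong (liftIdx d k) (liftIdx-< m n<k') ⟩
  liftIdx d k n                ≡⟨ liftIdx-< d (<-≤-trans n<k' k'≤k) ⟩
  n                            ≡⟨ liftIdx-< (d + m) n<k' ⟨
  liftIdx (d + m) k' n         ∎

lift-lift-var : ∀ d k m k' n → lift d k (lift m k' (var n)) ≡ var (liftIdx d k (liftIdx m k' n))
lift-lift-var d k m k' n rewrite lift-var m k' n = lift-var d k _

lift-comm : ∀ d m {k k'} T → k' ≤ k → lift d (k + m) (lift m k' T) ≡ lift m k' (lift d k T)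
lift-comm d m (sort h) _ = refl
lift-comm d m {k} {k'} (var n) k'≤k = begin
  lift d (k + m) (lift m k' (var n)) ≡⟨ lift-lift-var d (k + m) m k' n ⟩
  var _                              ≡⟨ cong var (liftIdx-comm d m n k'≤k) ⟩
  var _                              ≡⟨ lift-lift-var m k' d k n ⟨
  lift m k' (lift d k (var n))       ∎
lift-comm d m (abst W T) k'≤k = cong₂ abst (lift-comm d m W k'≤k) (lift-comm d m T (s≤s k'≤k))
lift-comm d m (abbr V T) k'≤k = cong₂ abbr (lift-comm d m V k'≤k) (lift-comm d m T (s≤s k'≤k))
lift-comm d m (appl V T) k'≤k = cong₂ appl (lift-comm d m V k'≤k) (lift-comm d m T k'≤k)
lift-comm d m (cast W T) k'≤k = cong₂ cast (lift-comm d m W k'≤k) (lift-comm d m T k'≤k)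

lift-comp : ∀ d m {k k'} T → k' ≤ k → k ≤ k' + m → lift d k (lift m k' T) ≡ lift (d + m) k' T
lift-comp d m (sort h) _ _ = refl
lift-comp d m {k} {k'} (var n) k'≤k k≤k'+m = begin
  lift d k (lift m k' (var n)) ≡⟨ lift-lift-var d k m k' n ⟩
  var _                        ≡⟨ cong var (liftIdx-comp d m n k'≤k k≤k'+m) ⟩
  var (liftIdx (d + m) k' n)   ≡⟨ lift-var (d + m) k' n ⟨
  lift (d + m) k' (var n)      ∎
lift-comp d m (abst W T) p q = cong₂ abst (lift-comp d m W p q) (lift-comp d m T (s≤s p) (s≤s q))
lift-comp d m (abbr V T) p q = cong₂ abbr (lift-comp d m V p q) (lift-comp d m T (s≤s p) (s≤s q))
lift-comp d m (appl V T) p q = cong₂ appl (lift-comp d m V p q) (lift-comp d m T p q)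
lift-comp d m (cast W T) p q = cong₂ cast (lift-comp d m W p q) (lift-comp d m T p q)

lift-comm₁ : ∀ d k T → lift d (suc k) (lift 1 0 T) ≡ lift 1 0 (lift d k T)
lift-comm₁ d k T =
  subst (λ j → lift d j (lift 1 0 T) ≡ lift 1 0 (lift d k T)) (+-comm k 1) (lift-comm d 1 T z≤n)

Free-lift⁻¹ : ∀ d k {i} T → i < k → Free i (lift d k T) → Free i T
Free-lift⁻¹ d k (sort h) i<k ()
Free-lift⁻¹ d k (var n) i<k f with k ≤? n | f
... | yes k≤n | fvar = ⊥-elim (<⇒≱ i<k (≤-trans k≤n (m≤n+m n d)))
... | no  _   | fvar = fvar
Free-lift⁻¹ d k (abst W T) i<k (fabstW f) = fabstW (Free-lift⁻¹ d k W i<k f)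
Free-lift⁻¹ d k (abst W T) i<k (fabstT f) = fabstT (Free-lift⁻¹ d (suc k) T (s≤s i<k) f)
Free-lift⁻¹ d k (abbr V T) i<k (fabbrV f) = fabbrV (Free-lift⁻¹ d k V i<k f)
Free-lift⁻¹ d k (abbr V T) i<k (fabbrT f) = fabbrT (Free-lift⁻¹ d (suc k) T (s≤s i<k) f)
Free-lift⁻¹ d k (appl V T) i<k (fapplV f) = fapplV (Free-lift⁻¹ d k V i<k f)
Free-lift⁻¹ d k (appl V T) i<k (fapplT f) = fapplT (Free-lift⁻¹ d k T i<k f)
Free-lift⁻¹ d k (cast W T) i<k (fcastW f) = fcastW (Free-lift⁻¹ d k W i<k f)
Free-lift⁻¹ d k (cast W T) i<k (fcastT f) = fcastT (Free-lift⁻¹ d k T i<k f)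

SubAny-lift : ∀ d k {i V T T'} → SubAny i V T T' →
              SubAny (liftIdx d k i) (lift d k V) (lift d k T) (lift d k T')
SubAny-lift-under : ∀ d k V {i T T'} → SubAny (suc i) (lift 1 0 V) T T' →
                    SubAny (suc (liftIdx d k i)) (lift 1 0 (lift d k V)) (lift d (suc k) T) (lift d (suc k) T')

SubAny-lift d k sa-sort = sa-sort
SubAny-lift d k {T = var n} sa-keep rewrite lift-var d k n = sa-keep
SubAny-lift d k {i} sa-repl rewrite lift-var d k i = sa-repl
SubAny-lift d k {V = V} (sa-abst σ τ) = sa-abst (SubAny-lift d k σ) (SubAny-lift-under d k V τ)
SubAny-lift d k {V = V} (sa-abbr σ τ) = sa-abbr (SubAny-lift d k σ) (SubAny-lift-under d k V τ)
SubAny-lift d k (sa-appl σ τ) = sa-appl (SubAny-lift d k σ) (SubAny-lift d k τ)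
SubAny-lift d k (sa-cast σ τ) = sa-cast (SubAny-lift d k σ) (SubAny-lift d k τ)

SubAny-lift-under d k V {i} σ =
  subst₂ (λ j X → SubAny j X _ _) (liftIdx-suc d k i) (lift-comm₁ d k V) (SubAny-lift d (suc k) σ)

SubStrict-lift : ∀ d k {i V T T'} → SubStrict i V T T' →
                 SubStrict (liftIdx d k i) (lift d k V) (lift d k T) (lift d k T')
SubStrict-lift-under : ∀ d k V {i T T'} → SubStrict (suc i) (lift 1 0 V) T T' →
                       SubStrict (suc (liftIdx d k i)) (lift 1 0 (lift d k V))
                                 (lift d (suc k) T) (lift d (suc k) T')

SubStrict-lift d k {i} ss-repl rewrite lift-var d k i = ss-repl
SubStrict-lift d k {V = V} (ss-abstA σ τ) = ss-abstA (SubStrict-lift d k σ) (SubAny-lift-under d k V τ)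
SubStrict-lift d k {V = V} (ss-abstT σ τ) = ss-abstT (SubAny-lift d k σ) (SubStrict-lift-under d k V τ)
SubStrict-lift d k {V = V} (ss-abbrA σ τ) = ss-abbrA (SubStrict-lift d k σ) (SubAny-lift-under d k V τ)
SubStrict-lift d k {V = V} (ss-abbrT σ τ) = ss-abbrT (SubAny-lift d k σ) (SubStrict-lift-under d k V τ)
SubStrict-lift d k (ss-applA σ τ) = ss-applA (SubStrict-lift d k σ) (SubAny-lift d k τ)
SubStrict-lift d k (ss-applT σ τ) = ss-applT (SubAny-lift d k σ) (SubStrict-lift d k τ)
SubStrict-lift d k (ss-castA σ τ) = ss-castA (SubStrict-lift d k σ) (SubAny-lift d k τ)
SubStrict-lift d k (ss-castT σ τ) = ss-castT (SubAny-lift d k σ) (SubStrict-lift d k τ)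

SubStrict-lift-under d k V {i} σ =
  subst₂ (λ j X → SubStrict j X _ _) (liftIdx-suc d k i) (lift-comm₁ d k V) (SubStrict-lift d (suc k) σ)

⇒₀-lift : ∀ d k {T₁ T₂} → T₁ ⇒₀ T₂ → lift d k T₁ ⇒₀ lift d k T₂
⇒₀-lift d k r-refl = r-refl
⇒₀-lift d k (r-abst ρ π) = r-abst (⇒₀-lift d k ρ) (⇒₀-lift d (suc k) π)
⇒₀-lift d k (r-abbr ρ π) = r-abbr (⇒₀-lift d k ρ) (⇒₀-lift d (suc k) π)
⇒₀-lift d k (r-appl ρ π) = r-appl (⇒₀-lift d k ρ) (⇒₀-lift d k π)
⇒₀-lift d k (r-cast ρ π) = r-cast (⇒₀-lift d k ρ) (⇒₀-lift d k π)
⇒₀-lift d k (r-beta ρ π) = r-beta (⇒₀-lift d k ρ) (⇒₀-lift d (suc k) π)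
⇒₀-lift d k (r-delta {V₂ = V₂} ρ π σ) =
  r-delta (⇒₀-lift d k ρ) (⇒₀-lift d (suc k) π)
          (subst (λ X → SubStrict 0 X _ _) (lift-comm₁ d k V₂) (SubStrict-lift d (suc k) σ))
⇒₀-lift d k (r-zeta {T₁ = T₁} {T₂} ρ 0∉T₁) =
  r-zeta (subst (lift d (suc k) T₁ ⇒₀_) (lift-comm₁ d k T₂) (⇒₀-lift d (suc k) ρ))
         (λ 0∈T₁ → 0∉T₁ (Free-lift⁻¹ d (suc k) T₁ (s≤s z≤n) 0∈T₁))
⇒₀-lift d k (r-tau ρ) = r-tau (⇒₀-lift d k ρ)
⇒₀-lift d k (r-upsilon {V₃ = V₃} ρ π υ) =
  subst (λ X → _ ⇒₀ abbr _ (appl X _)) (sym (lift-comm₁ d k V₃))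
        (r-upsilon (⇒₀-lift d k ρ) (⇒₀-lift d k π) (⇒₀-lift d (suc k) υ))

split-at-∷ : ∀ {a} {A : Set a} (xs ys us vs : List A) x → xs ++ ys ≡ us ++ x ∷ vs →
             (∃[ zs ] xs ≡ us ++ x ∷ zs × vs ≡ zs ++ ys) ⊎
             (∃[ zs ] ys ≡ zs ++ x ∷ vs × us ≡ xs ++ zs)
split-at-∷ []       ys us       vs x eq = inj₂ (us , eq , refl)
split-at-∷ (y ∷ xs) ys []       vs x eq with ∷-injective eq
... | refl , eq' = inj₁ (xs , refl , sym eq')
split-at-∷ (y ∷ xs) ys (u ∷ us) vs x eq with ∷-injective eq
... | refl , eq' with split-at-∷ xs ys us vs x eq'
...   | inj₁ (zs , xs≡ , vs≡) = inj₁ (zs , cong (y ∷_) xs≡ , vs≡)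
...   | inj₂ (zs , ys≡ , us≡) = inj₂ (zs , ys≡ , cong (y ∷_) us≡)

data Binder : Set where
  decl defn : Binder

bindEnv : Binder → Term → Env → Env
bindEnv decl = eabst
bindEnv defn = eabbr

_∙⟨_⟩_ : Env → Binder → Term → Env
E ∙⟨ β ⟩ X = plug E (bindEnv β X (esort (tsort E)))

data Item : Set where
  bind  : Binder → Term → Item
  applᵢ : Term → Item
  castᵢ : Term → Item

infixr 5 _++ᴱ_
_++ᴱ_ : List Item → Env → Env
[]             ++ᴱ E = E
(bind β X ∷ s) ++ᴱ E = bindEnv β X (s ++ᴱ E)
(applᵢ V ∷ s)  ++ᴱ E = eappl V (s ++ᴱ E)
(castᵢ W ∷ s)  ++ᴱ E = ecast W (s ++ᴱ E)

items : Env → List Item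
items (esort _)   = []
items (eabst W E) = bind decl W ∷ items E
items (eabbr V E) = bind defn V ∷ items E
items (eappl V E) = applᵢ V ∷ items E
items (ecast W E) = castᵢ W ∷ items E

binders : List Item → ℕ
binders []             = 0
binders (bind _ _ ∷ s) = suc (binders s)
binders (applᵢ _ ∷ s)  = binders s
binders (castᵢ _ ∷ s)  = binders s

liftItems : ℕ → ℕ → List Item → List Item
liftItems d k []             = []
liftItems d k (bind β X ∷ s) = bind β (lift d k X) ∷ liftItems d (suc k) s
liftItems d k (applᵢ V ∷ s)  = applᵢ (lift d k V) ∷ liftItems d k s
liftItems d k (castᵢ W ∷ s)  = castᵢ (lift d k W) ∷ liftItems d k s

++ᴱ-++ : ∀ s t E → (s ++ t) ++ᴱ E ≡ s ++ᴱ t ++ᴱ E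
++ᴱ-++ []             t E = refl
++ᴱ-++ (bind β X ∷ s) t E = cong (bindEnv β X) (++ᴱ-++ s t E)
++ᴱ-++ (applᵢ V ∷ s)  t E = cong (eappl V) (++ᴱ-++ s t E)
++ᴱ-++ (castᵢ W ∷ s)  t E = cong (ecast W) (++ᴱ-++ s t E)

items-++ᴱ : ∀ s E → items (s ++ᴱ E) ≡ s ++ items E
items-++ᴱ []                E = refl
items-++ᴱ (bind decl X ∷ s) E = cong (bind decl X ∷_) (items-++ᴱ s E)
items-++ᴱ (bind defn X ∷ s) E = cong (bind defn X ∷_) (items-++ᴱ s E)
items-++ᴱ (applᵢ V ∷ s)     E = cong (applᵢ V ∷_) (items-++ᴱ s E)
items-++ᴱ (castᵢ W ∷ s)     E = cong (castᵢ W ∷_) (items-++ᴱ s E)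

items-++ᴱ-esort : ∀ s h → items (s ++ᴱ esort h) ≡ s
items-++ᴱ-esort s h = trans (items-++ᴱ s (esort h)) (++-identityʳ s)

++ᴱ-items : ∀ E → items E ++ᴱ esort (tsort E) ≡ E
++ᴱ-items (esort h)   = refl
++ᴱ-items (eabst W E) = cong (eabst W) (++ᴱ-items E)
++ᴱ-items (eabbr V E) = cong (eabbr V) (++ᴱ-items E)
++ᴱ-items (eappl V E) = cong (eappl V) (++ᴱ-items E)
++ᴱ-items (ecast W E) = cong (ecast W) (++ᴱ-items E)

plug-++ᴱ : ∀ C E → plug C E ≡ items C ++ᴱ E
plug-++ᴱ (esort h)   E = refl
plug-++ᴱ (eabst W C) E = cong (eabst W) (plug-++ᴱ C E)
plug-++ᴱ (eabbr V C) E = cong (eabbr V) (plug-++ᴱ C E)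
plug-++ᴱ (eappl V C) E = cong (eappl V) (plug-++ᴱ C E)
plug-++ᴱ (ecast W C) E = cong (ecast W) (plug-++ᴱ C E)

plug-++ᴱ-esort : ∀ s h E → plug (s ++ᴱ esort h) E ≡ s ++ᴱ E
plug-++ᴱ-esort s h E = trans (plug-++ᴱ (s ++ᴱ esort h) E) (cong (_++ᴱ E) (items-++ᴱ-esort s h))

∙-++ᴱ : ∀ s h β X → (s ++ᴱ esort h) ∙⟨ β ⟩ X ≡ (s ++ [ bind β X ]) ++ᴱ esort h
∙-++ᴱ []                h β X = refl
∙-++ᴱ (bind decl W ∷ s) h β X = cong (eabst W) (∙-++ᴱ s h β X)
∙-++ᴱ (bind defn V ∷ s) h β X = cong (eabbr V) (∙-++ᴱ s h β X)
∙-++ᴱ (applᵢ V ∷ s)     h β X = cong (eappl V) (∙-++ᴱ s h β X)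
∙-++ᴱ (castᵢ W ∷ s)     h β X = cong (ecast W) (∙-++ᴱ s h β X)

binders-items : ∀ E → binders (items E) ≡ nb E
binders-items (esort h)   = refl
binders-items (eabst W E) = cong suc (binders-items E)
binders-items (eabbr V E) = cong suc (binders-items E)
binders-items (eappl V E) = binders-items E
binders-items (ecast W E) = binders-items E

nb-++ᴱ-esort : ∀ s h → nb (s ++ᴱ esort h) ≡ binders s
nb-++ᴱ-esort s h = trans (sym (binders-items (s ++ᴱ esort h))) (cong binders (items-++ᴱ-esort s h))

binders-++ : ∀ s t → binders (s ++ t) ≡ binders s + binders t
binders-++ []             t = refl
binders-++ (bind β X ∷ s) t = cong suc (binders-++ s t)
binders-++ (applᵢ V ∷ s)  t = binders-++ s t
binders-++ (castᵢ W ∷ s)  t = binders-++ s t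

binders-liftItems : ∀ d k s → binders (liftItems d k s) ≡ binders s
binders-liftItems d k []             = refl
binders-liftItems d k (bind β X ∷ s) = cong suc (binders-liftItems d (suc k) s)
binders-liftItems d k (applᵢ V ∷ s)  = binders-liftItems d k s
binders-liftItems d k (castᵢ W ∷ s)  = binders-liftItems d k s

liftItems-++ : ∀ d k s t → liftItems d k (s ++ t) ≡ liftItems d k s ++ liftItems d (k + binders s) t
liftItems-++ d k [] t rewrite +-identityʳ k = refl
liftItems-++ d k (bind β X ∷ s) t rewrite +-suc k (binders s) =
  cong (bind β (lift d k X) ∷_) (liftItems-++ d (suc k) s t)
liftItems-++ d k (applᵢ V ∷ s)  t = cong (applᵢ (lift d k V) ∷_) (liftItems-++ d k s t)
liftItems-++ d k (castᵢ W ∷ s)  t = cong (castᵢ (lift d k W) ∷_) (liftItems-++ d k s t)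

record Thinning (d b : ℕ) (E E' : Env) : Set where
  constructor thinning
  field
    outer inner inserted : List Item
    h h' : ℕ
    source : E ≡ (outer ++ inner) ++ᴱ esort h
    target : E' ≡ (outer ++ inserted ++ liftItems d 0 inner) ++ᴱ esort h'
    size : binders inserted ≡ d
    depth : binders inner ≡ b

thinning-plug : ∀ C E → Thinning (nb E) 0 C (plug C E)
thinning-plug C E = thinning (items C) [] (items E) (tsort C) (tsort E) source target (binders-items E) refl
  where
  source : C ≡ (items C ++ []) ++ᴱ esort (tsort C)
  source = trans (sym (++ᴱ-items C)) (cong (_++ᴱ esort (tsort C)) (sym (++-identityʳ (items C))))
  target : plug C E ≡ (items C ++ items E ++ []) ++ᴱ esort (tsort E)
  target = begin
    plug C E                                  ≡⟨ plug-++ᴱ C E ⟩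
    items C ++ᴱ E                             ≡⟨ cong (items C ++ᴱ_) (++ᴱ-items E) ⟨
    items C ++ᴱ items E ++ᴱ esort (tsort E)   ≡⟨ ++ᴱ-++ (items C) (items E) _ ⟨
    (items C ++ items E) ++ᴱ esort (tsort E)
      ≡⟨ cong (λ s → (items C ++ s) ++ᴱ esort (tsort E)) (++-identityʳ (items E)) ⟨
    (items C ++ items E ++ []) ++ᴱ esort (tsort E) ∎

thinning-∙ : ∀ {d b E E'} β X → Thinning d b E E' →
             Thinning d (suc b) (E ∙⟨ β ⟩ X) (E' ∙⟨ β ⟩ lift d b X)
thinning-∙ β X (thinning outer inner inserted h h' refl refl refl refl) =
  thinning outer (inner ++ [ bind β X ]) inserted h h' source target refl depth
  where
  d b : ℕ
  d = binders inserted
  b = binders inner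
  source : ((outer ++ inner) ++ᴱ esort h) ∙⟨ β ⟩ X ≡ (outer ++ inner ++ [ bind β X ]) ++ᴱ esort h
  source = trans (∙-++ᴱ (outer ++ inner) h β X) (cong (_++ᴱ esort h) (++-assoc outer inner _))
  target : ((outer ++ inserted ++ liftItems d 0 inner) ++ᴱ esort h') ∙⟨ β ⟩ lift d b X
         ≡ (outer ++ inserted ++ liftItems d 0 (inner ++ [ bind β X ])) ++ᴱ esort h'
  target = begin
    ((outer ++ inserted ++ liftItems d 0 inner) ++ᴱ esort h') ∙⟨ β ⟩ lift d b X
      ≡⟨ ∙-++ᴱ (outer ++ inserted ++ liftItems d 0 inner) h' β (lift d b X) ⟩
    ((outer ++ inserted ++ liftItems d 0 inner) ++ [ bind β (lift d b X) ]) ++ᴱ esort h'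
      ≡⟨ cong (_++ᴱ esort h') (trans (++-assoc outer _ _) (cong (outer ++_) (++-assoc inserted _ _))) ⟩
    (outer ++ inserted ++ liftItems d 0 inner ++ [ bind β (lift d b X) ]) ++ᴱ esort h'
      ≡⟨ cong (λ s → (outer ++ inserted ++ s) ++ᴱ esort h') (liftItems-++ d 0 inner _) ⟨
    (outer ++ inserted ++ liftItems d 0 (inner ++ [ bind β X ])) ++ᴱ esort h' ∎
  depth : binders (inner ++ [ bind β X ]) ≡ suc b
  depth = trans (binders-++ inner _) (+-comm b 1)

-- A binder of E before the insertion point is unchanged in E' and its index grows by d;
-- a binder after it is lifted along with its context and keeps its index.
data BinderPosition (d b : ℕ) (C₁ : Env) (β : Binder) (X : Term) (C₂ E' : Env) : Set where
  outside : ∀ C₂' → E' ≡ plug C₁ (bindEnv β X C₂') →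
            liftIdx d b (nb C₂) ≡ nb C₂' →
            (∀ W → lift d b (lift (suc (nb C₂)) 0 W) ≡ lift (suc (nb C₂')) 0 W) →
            BinderPosition d b C₁ β X C₂ E'
  inside  : ∀ r C₁' C₂' → Thinning d r C₁ C₁' →
            E' ≡ plug C₁' (bindEnv β (lift d r X) C₂') →
            liftIdx d b (nb C₂) ≡ nb C₂' →
            (∀ W → lift d b (lift (suc (nb C₂)) 0 W) ≡ lift (suc (nb C₂')) 0 (lift d r W)) →
            BinderPosition d b C₁ β X C₂ E'

liftIdx-outside : ∀ d b r {n n'} → n ≡ r + b → n' ≡ r + (d + b) → liftIdx d b n ≡ n'
liftIdx-outside d b r refl refl = trans (liftIdx-≥ d (m≤n+m b r)) (x∙yz≈y∙xz d r b)

lift-outside : ∀ d b r {n n'} → n ≡ r + b → n' ≡ r + (d + b) →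
               ∀ W → lift d b (lift (suc n) 0 W) ≡ lift (suc n') 0 W
lift-outside d b r refl refl W = begin
  lift d b (lift (suc (r + b)) 0 W) ≡⟨ lift-comp d (suc (r + b)) W z≤n (m≤n⇒m≤1+n (m≤n+m b r)) ⟩
  lift (d + suc (r + b)) 0 W        ≡⟨ cong (λ m → lift m 0 W) (+-suc d (r + b)) ⟩
  lift (suc (d + (r + b))) 0 W      ≡⟨ cong (λ m → lift (suc m) 0 W) (x∙yz≈y∙xz d r b) ⟩
  lift (suc (r + (d + b))) 0 W      ∎

liftIdx-inside : ∀ d r {b c c'} → b ≡ r + suc c → c' ≡ c → liftIdx d b c ≡ c'
liftIdx-inside d r {c = c} refl refl = liftIdx-< d (m≤n+m (suc c) r)

lift-inside : ∀ d r {b c c'} → b ≡ r + suc c → c' ≡ c →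
              ∀ W → lift d b (lift (suc c) 0 W) ≡ lift (suc c') 0 (lift d r W)
lift-inside d r {c = c} refl refl W = lift-comm d (suc c) W z≤n

items-plug-bindEnv : ∀ C₁ β X C₂ → items (plug C₁ (bindEnv β X C₂)) ≡ items C₁ ++ bind β X ∷ items C₂
items-plug-bindEnv C₁ β X C₂ = begin
  items (plug C₁ (bindEnv β X C₂))    ≡⟨ cong items (plug-++ᴱ C₁ _) ⟩
  items (items C₁ ++ᴱ bindEnv β X C₂) ≡⟨ items-++ᴱ (items C₁) _ ⟩
  items C₁ ++ items (bindEnv β X C₂)  ≡⟨ cong (items C₁ ++_) (items-++ᴱ [ bind β X ] C₂) ⟩
  items C₁ ++ bind β X ∷ items C₂     ∎

binderPosition-outside : ∀ {E'} C₁ β X C₂ R inner inserted h' → items C₂ ≡ R ++ inner →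
  E' ≡ ((items C₁ ++ bind β X ∷ R) ++ inserted ++ liftItems (binders inserted) 0 inner) ++ᴱ esort h' →
  BinderPosition (binders inserted) (binders inner) C₁ β X C₂ E'
binderPosition-outside {E'} C₁ β X C₂ R inner inserted h' C₂≡R++inner E'≡ =
  outside C₂' E'≡plug (liftIdx-outside d b r nb₂ nb₂') (lift-outside d b r nb₂ nb₂')
  where
  d b r : ℕ
  d = binders inserted
  b = binders inner
  r = binders R
  L : List Item
  L = liftItems d 0 inner
  C₂' : Env
  C₂' = (R ++ inserted ++ L) ++ᴱ esort h'
  E'≡plug : E' ≡ plug C₁ (bindEnv β X C₂')
  E'≡plug = begin
    E'                                                         ≡⟨ E'≡ ⟩
    ((items C₁ ++ bind β X ∷ R) ++ inserted ++ L) ++ᴱ esort h' ≡⟨ cong (_++ᴱ esort h') (++-assoc (items C₁) _ _) ⟩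
    (items C₁ ++ bind β X ∷ R ++ inserted ++ L) ++ᴱ esort h'   ≡⟨ ++ᴱ-++ (items C₁) _ _ ⟩
    items C₁ ++ᴱ bindEnv β X C₂'                               ≡⟨ plug-++ᴱ C₁ _ ⟨
    plug C₁ (bindEnv β X C₂')                                  ∎
  nb₂ : nb C₂ ≡ r + b
  nb₂ = trans (sym (binders-items C₂)) (trans (cong binders C₂≡R++inner) (binders-++ R inner))
  nb₂' : nb C₂' ≡ r + (d + b)
  nb₂' = begin
    nb C₂'                       ≡⟨ nb-++ᴱ-esort (R ++ inserted ++ L) h' ⟩
    binders (R ++ inserted ++ L) ≡⟨ binders-++ R _ ⟩
    r + binders (inserted ++ L)  ≡⟨ cong (r +_) (binders-++ inserted L) ⟩
    r + (d + binders L)          ≡⟨ cong (λ n → r + (d + n)) (binders-liftItems d 0 inner) ⟩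
    r + (d + b)                  ∎

binderPosition-inside : ∀ {E'} C₁ β X C₂ outer R inserted h' → items C₁ ≡ outer ++ R →
  E' ≡ (outer ++ inserted ++ liftItems (binders inserted) 0 (R ++ bind β X ∷ items C₂)) ++ᴱ esort h' →
  BinderPosition (binders inserted) (binders (R ++ bind β X ∷ items C₂)) C₁ β X C₂ E'
binderPosition-inside {E'} C₁ β X C₂ outer R inserted h' C₁≡outer++R E'≡ =
  inside r C₁' C₂' θ E'≡plug (liftIdx-inside d r b≡ nb₂') (lift-inside d r b≡ nb₂')
  where
  d r : ℕ
  d = binders inserted
  r = binders R
  P S : List Item
  P = outer ++ inserted ++ liftItems d 0 R
  S = liftItems d (suc r) (items C₂)
  C₁' C₂' : Env
  C₁' = P ++ᴱ esort h'
  C₂' = S ++ᴱ esort h'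
  θ : Thinning d r C₁ C₁'
  θ = thinning outer R inserted (tsort C₁) h'
               (trans (sym (++ᴱ-items C₁)) (cong (_++ᴱ esort (tsort C₁)) C₁≡outer++R)) refl refl refl
  E'≡plug : E' ≡ plug C₁' (bindEnv β (lift d r X) C₂')
  E'≡plug = begin
    E'                                                                 ≡⟨ E'≡ ⟩
    (outer ++ inserted ++ liftItems d 0 (R ++ bind β X ∷ items C₂)) ++ᴱ esort h'
      ≡⟨ cong (λ s → (outer ++ inserted ++ s) ++ᴱ esort h') (liftItems-++ d 0 R _) ⟩
    (outer ++ inserted ++ liftItems d 0 R ++ bind β (lift d r X) ∷ S) ++ᴱ esort h'
      ≡⟨ cong (_++ᴱ esort h') (sym (trans (++-assoc outer _ _) (cong (outer ++_) (++-assoc inserted _ _)))) ⟩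
    (P ++ bind β (lift d r X) ∷ S) ++ᴱ esort h'                        ≡⟨ ++ᴱ-++ P _ _ ⟩
    P ++ᴱ bindEnv β (lift d r X) C₂'                                   ≡⟨ plug-++ᴱ-esort P h' _ ⟨
    plug C₁' (bindEnv β (lift d r X) C₂')                              ∎
  b≡ : binders (R ++ bind β X ∷ items C₂) ≡ r + suc (nb C₂)
  b≡ = trans (binders-++ R _) (cong (λ n → r + suc n) (binders-items C₂))
  nb₂' : nb C₂' ≡ nb C₂
  nb₂' = begin
    nb C₂'             ≡⟨ nb-++ᴱ-esort S h' ⟩
    binders S          ≡⟨ binders-liftItems d (suc r) (items C₂) ⟩
    binders (items C₂) ≡⟨ binders-items C₂ ⟩
    nb C₂              ∎

binderPosition : ∀ {d b E'} C₁ β X C₂ → Thinning d b (plug C₁ (bindEnv β X C₂)) E' →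
                 BinderPosition d b C₁ β X C₂ E'
binderPosition C₁ β X C₂ (thinning outer inner inserted h h' source target refl refl)
  with split-at-∷ outer inner (items C₁) (items C₂) (bind β X) items≡
  where
  items≡ : outer ++ inner ≡ items C₁ ++ bind β X ∷ items C₂
  items≡ = begin
    outer ++ inner                       ≡⟨ items-++ᴱ-esort (outer ++ inner) h ⟨
    items ((outer ++ inner) ++ᴱ esort h) ≡⟨ cong items source ⟨
    items (plug C₁ (bindEnv β X C₂))     ≡⟨ items-plug-bindEnv C₁ β X C₂ ⟩
    items C₁ ++ bind β X ∷ items C₂      ∎
... | inj₁ (R , refl , C₂≡R++inner) =
  binderPosition-outside C₁ β X C₂ R inner inserted h' C₂≡R++inner target
... | inj₂ (R , refl , C₁≡outer++R) =
  binderPosition-inside C₁ β X C₂ outer R inserted h' C₁≡outer++R target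

SubStrict-lift-to : ∀ d b {i i' V V' T T'} → liftIdx d b i ≡ i' → lift d b V ≡ V' →
                    SubStrict i V T T' → SubStrict i' V' (lift d b T) (lift d b T')
SubStrict-lift-to d b refl refl = SubStrict-lift d b

Red-weaken : ∀ {d b E E' T₁ T₂} → Red E T₁ T₂ → Thinning d b E E' →
             Red E' (lift d b T₁) (lift d b T₂)
Red-weaken {d} {b} (red0 ρ) θ = red0 (⇒₀-lift d b ρ)
Red-weaken {d} {b} (redδ C₁ V C₂ T' refl ρ σ) θ with binderPosition C₁ defn V C₂ θ
... | outside C₂' eq idx ty =
  redδ C₁ V C₂' _ eq (⇒₀-lift d b ρ) (SubStrict-lift-to d b idx (ty V) σ)
... | inside r C₁' C₂' _ eq idx ty =
  redδ C₁' (lift d r V) C₂' _ eq (⇒₀-lift d b ρ) (SubStrict-lift-to d b idx (ty V) σ)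

Conv-weaken : ∀ {d b E E' T₁ T₂} → Conv E T₁ T₂ → Thinning d b E E' →
              Conv E' (lift d b T₁) (lift d b T₂)
Conv-weaken (c-step ρ)     θ = c-step (Red-weaken ρ θ)
Conv-weaken (c-sym c)      θ = c-sym (Conv-weaken c θ)
Conv-weaken (c-trans c c') θ = c-trans (Conv-weaken c θ) (Conv-weaken c' θ)

Typed-lift-var-to : ∀ {g d b E n n' U U'} → liftIdx d b n ≡ n' → U ≡ U' →
                    Typed g E (var n') U' → Typed g E (lift d b (var n)) U
Typed-lift-var-to {g} {d} {b} {E} {n} refl refl = subst (λ T → Typed g E T _) (sym (lift-var d b n))

weaken : ∀ {g d b E E' T U} → Typed g E T U → Thinning d b E E' →
         Typed g E' (lift d b T) (lift d b U)
weaken t-sort θ = t-sort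
weaken (t-def {C₁ = C₁} {V} {C₂} {W} refl tv) θ with binderPosition C₁ defn V C₂ θ
... | outside _ eq idx ty       = Typed-lift-var-to idx (ty W) (t-def eq tv)
... | inside _ _ _ θ' eq idx ty = Typed-lift-var-to idx (ty W) (t-def eq (weaken tv θ'))
weaken (t-decl {C₁ = C₁} {W} {C₂} refl tw) θ with binderPosition C₁ decl W C₂ θ
... | outside _ eq idx ty       = Typed-lift-var-to idx (ty W) (t-decl eq tw)
... | inside _ _ _ θ' eq idx ty = Typed-lift-var-to idx (ty W) (t-decl eq (weaken tw θ'))
weaken (t-abbr {V = V} tv tt) θ = t-abbr (weaken tv θ) (weaken tt (thinning-∙ defn V θ))
weaken (t-abst {W = W} tw tt) θ = t-abst (weaken tw θ) (weaken tt (thinning-∙ decl W θ))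
weaken (t-appl tv tt)         θ = t-appl (weaken tv θ) (weaken tt θ)
weaken (t-cast tt tw)         θ = t-cast (weaken tt θ) (weaken tw θ)
weaken (t-conv tu tt c)       θ = t-conv (weaken tu θ) (weaken tt θ) (Conv-weaken c θ)

Typed-abst⁻¹ : ∀ {g E W T U} → Typed g E (abst W T) U →
               ∃[ V ] ∃[ U' ] Typed g E W V × Typed g (E ∙λ W) T U'
Typed-abst⁻¹ (t-abst tw tt)  = _ , _ , tw , tt
Typed-abst⁻¹ (t-conv _ tt _) = Typed-abst⁻¹ tt

type-correctness : ∀ {g E T U} → Typed g E T U → ∃ (Typed g E U)
type-correctness t-sort = _ , t-sort
type-correctness (t-def {C₁ = C₁} refl tv) with type-correctness tv
... | _ , tw = _ , weaken tw (thinning-plug C₁ _)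
type-correctness (t-decl {C₁ = C₁} refl tw) = _ , weaken tw (thinning-plug C₁ _)
type-correctness (t-abbr tv tt) with type-correctness tt
... | _ , tu = _ , t-abbr tv tu
type-correctness (t-abst tw tt) with type-correctness tt
... | _ , tu = _ , t-abst tw tu
type-correctness (t-appl tv tt) with type-correctness tt
... | _ , tf with Typed-abst⁻¹ tf
...   | _ , _ , tw , tu = _ , t-appl tv (t-abst tw tu)
type-correctness (t-cast tt tw) with type-correctness tw
... | _ , tv = _ , t-cast tw tv
type-correctness (t-conv tu _ _) = _ , tu

mainTheorem6 : (g : ℕ → ℕ) → (∀ h → h < g h) →
               ∀ (C : Env) (T₁ T₂ : Term) → Typed g C T₁ T₂ →
               ∃ λ T₃ → Typed g C T₂ T₃
mainTheorem6 g _ C T₁ T₂ = type-correctness
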